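{- For each integer $d\ge0$, $\tilde{A}_d=\hat{A}_d\cap\mathrm{RGF}$.
   Context: All sequences are finite words $\alpha=a_1\ldots a_n$ ($n\ge0$) of positive integers. For an integer $d\ge 0$, an index $i\in[n]$ is a $d$-ascent of $\alpha$ if $i=1$, or $i\ge 2$ and $a_i>a_{i-1}-d$; $\mathrm{asc}_d\alpha$ is the number of $d$-ascents. $\alpha$ is a $d$-ascent sequence if $a_i\le1+\mathrm{asc}_d(a_1\ldots a_{i-1})$ for all $i\in[n]$; $A_d$ is the set of these. For a word $\alpha$ and index $j$, $M(\alpha,j)$ adds $1$ to every $a_i$ with $i<j$ and $a_i\ge a_j$; $M(\alpha,j_1,\dots,j_k)=M(M(\alpha,j_1,\dots,j_{k-1}),j_k)$; $\mathrm{hat}_d(\alpha)=M(\alpha,j_1,\dots,j_k)$ with $j_1<\dots<j_k$ the $d$-ascents of $\alpha$. $\hat{A}_d=\{\mathrm{hat}_d(\alpha):\alpha\in A_d\}$, $\tilde{A}_d=\{\alpha\in A_d:\mathrm{hat}_d(\alpha)=\alpha\}$. $\mathrm{RGF}$ is the set of restricted growth functions: words $\alpha$ (including the empty word) with $a_1=1$ and $a_{i+1}\le1+\max(a_1\ldots a_i)$ for each $i\in[n-1]$. -}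

module Defs where

open import Data.Nat using (ℕ; zero; suc; _+_; _≤_; _<_; _<ᵇ_; _≤ᵇ_)
open import Data.Bool using (Bool; true; false; if_then_else_)
open import Data.List using (List; []; _∷_; _++_; length; take; foldl; reverse)
open import Data.List.Relation.Unary.All using (All)
open import Data.Product using (Σ; _×_)
open import Relation.Binary.PropositionalEquality using (_≡_)

-- Words are lists of naturals a₁ … aₙ; "positive integers" is imposed by
-- the predicate Positive.  Indices are 1-based, as in the paper.
Word : Set
Word = List ℕ

Positive : Word → Set
Positive α = All (λ a → 1 ≤ a) α

-- Indices that are d-ascents: i = 1, or a_i > a_{i-1} - d.
-- Over the integers a_i > a_{i-1} - d  ⇔  a_{i-1} < a_i + d (no truncation).
-- ascIdx d prev i rest : indices (starting at i) of d-ascents of rest,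
-- where prev is the entry preceding rest.
ascIdxFrom : ℕ → ℕ → ℕ → Word → List ℕ
ascIdxFrom d prev i [] = []
ascIdxFrom d prev i (a ∷ rest) =
  if prev <ᵇ (a + d)
  then i ∷ ascIdxFrom d a (suc i) rest
  else ascIdxFrom d a (suc i) rest

ascents : ℕ → Word → List ℕ
ascents d [] = []
ascents d (a ∷ rest) = 1 ∷ ascIdxFrom d a 2 rest

asc : ℕ → Word → ℕ
asc d α = length (ascents d α)

AscCond : ℕ → Word → Word → Set
AscCond d pre [] = Data.Unit.⊤
  where import Data.Unit
AscCond d pre (a ∷ rest) = (a ≤ 1 + asc d pre) × AscCond d (pre ++ (a ∷ [])) rest

IsAsc : ℕ → Word → Set
IsAsc d α = Positive α × AscCond d [] α

-- j-th entry (1-based); 0 if out of range (never used then, see M)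
nth : Word → ℕ → ℕ
nth [] j = 0
nth (a ∷ α) zero = 0
nth (a ∷ α) (suc zero) = a
nth (a ∷ α) (suc (suc j)) = nth α (suc j)

bumpBefore : ℕ → ℕ → ℕ → Word → Word
bumpBefore v i j [] = []
bumpBefore v i j (a ∷ α) =
  (if (i <ᵇ j) Data.Bool.∧ (v ≤ᵇ a) then suc a else a) ∷ bumpBefore v (suc i) j α
  where import Data.Bool

M : Word → ℕ → Word
M α j = bumpBefore (nth α j) 1 j α

Ms : Word → List ℕ → Word
Ms α js = foldl M α js

hat : ℕ → Word → Word
hat d α = Ms α (ascents d α)

InHatA : ℕ → Word → Set
InHatA d α = Σ Word (λ β → IsAsc d β × hat d β ≡ α)

InTildeA : ℕ → Word → Set
InTildeA d α = IsAsc d α × hat d α ≡ α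

maxW : Word → ℕ
maxW [] = 0
maxW (a ∷ α) = a Data.Nat.⊔ maxW α
  where import Data.Nat

RGFCond : Word → Word → Set
RGFCond pre [] = Data.Unit.⊤
  where import Data.Unit
RGFCond pre (a ∷ rest) = (a ≤ 1 + maxW pre) × RGFCond (pre ++ (a ∷ [])) rest

IsRGF : Word → Set
IsRGF [] = Data.Unit.⊤
  where import Data.Unit
IsRGF (a ∷ α) = Positive (a ∷ α) × a ≡ 1 × RGFCond (a ∷ []) α

module Submission where

-- hat_d scans the word from left to right and, at each d-ascent entry b, raises
-- by one every earlier entry ≥ b.  Raising is injective and reflects ascents,
-- so in hat_d β the entry at every d-ascent differs from all earlier entries.
-- In a restricted growth function such a fresh entry must be a new maximum, so
-- the raisings at its ascents are all vacuous and hat_d fixes it; and since every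
-- new maximum is a d-ascent, an RGF is a d-ascent sequence.  Conversely, in a
-- d-ascent sequence whose ascent entries are fresh, the number of ascents never
-- exceeds the maximum, so each ascent entry is at most 1 + max and new, i.e. the
-- next maximum: the sequence is an RGF.

open import Defs
open import Data.Nat using (ℕ; suc; _+_; _≤_; _<_; _<ᵇ_; _≤ᵇ_; _⊔_; _≤?_; z≤n; s≤s)
open import Data.Nat.Properties
open import Data.Bool using (Bool; true; false; if_then_else_; T)
open import Data.Unit using (⊤; tt)
open import Data.Empty using (⊥-elim)
open import Data.List using ([]; _∷_; _++_; _∷ʳ_; length; foldl; map)
open import Data.List.Properties using (map-++; ++-assoc; ++-identityʳ; length-++; length-map)
open import Data.List.Relation.Unary.All as All using (All; []; _∷_)
open import Data.List.Relation.Unary.Any using (here)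
open import Data.List.Membership.Propositional using (_∈_; _∉_)
open import Data.List.Membership.Propositional.Properties using (∈-map⁻; ∈-++⁺ˡ; ∈-++⁺ʳ)
open import Data.Product using (_×_; _,_)
open import Data.Sum using (inj₁; inj₂)
open import Function.Bundles using (_⇔_; mk⇔)
open import Relation.Binary.Definitions using (tri<; tri≈; tri>)
open import Relation.Binary.PropositionalEquality
open import Relation.Nullary using (¬_; yes; no; contradiction)
open import Relation.Nullary.Decidable using (T?)

bump : ℕ → ℕ → ℕ
bump c a = if c ≤ᵇ a then suc a else a

bump-≥ : ∀ {c a} → c ≤ a → bump c a ≡ suc a
bump-≥ {c} {a} c≤a with c ≤ᵇ a | ≤⇒≤ᵇ c≤a
... | true  | _ = refl
... | false | ()

bump-< : ∀ {c a} → a < c → bump c a ≡ a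
bump-< {c} {a} a<c with c ≤ᵇ a | ≤ᵇ⇒≤ c a
... | true  | c≤a = contradiction (c≤a tt) (<⇒≱ a<c)
... | false | _   = refl

bump-mono-< : ∀ c {x y} → x < y → bump c x < bump c y
bump-mono-< c {x} {y} x<y with c ≤? x | c ≤? y
... | yes c≤x | yes c≤y rewrite bump-≥ c≤x | bump-≥ c≤y = s≤s x<y
... | yes c≤x | no  c≰y = contradiction (≤-trans c≤x (<⇒≤ x<y)) c≰y
... | no  c≰x | yes c≤y rewrite bump-< (≰⇒> c≰x) | bump-≥ c≤y = m<n⇒m<1+n x<y
... | no  c≰x | no  c≰y rewrite bump-< (≰⇒> c≰x) | bump-< (≰⇒> c≰y) = x<y

bump-injective : ∀ c {x y} → bump c x ≡ bump c y → x ≡ y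
bump-injective c {x} {y} eq with <-cmp x y
... | tri< x<y _ _ = contradiction eq (<⇒≢ (bump-mono-< c x<y))
... | tri≈ _ x≡y _ = x≡y
... | tri> _ _ y<x = contradiction (sym eq) (<⇒≢ (bump-mono-< c y<x))

bump-≢ : ∀ c a → bump c a ≢ c
bump-≢ c a with c ≤? a
... | yes c≤a rewrite bump-≥ c≤a = >⇒≢ (s≤s c≤a)
... | no  c≰a rewrite bump-< (≰⇒> c≰a) = <⇒≢ (≰⇒> c≰a)

bump-reflects-ascent : ∀ c {u a} d → bump c u < bump c a + d → u < a + d
bump-reflects-ascent c {u} {a} d lt with c ≤? u | c ≤? a
... | yes c≤u | yes c≤a rewrite bump-≥ c≤u | bump-≥ c≤a = ≤-pred lt
... | yes c≤u | no  c≰a rewrite bump-≥ c≤u | bump-< (≰⇒> c≰a) = <⇒≤ lt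
... | no  c≰u | yes c≤a = ≤-trans (≤-trans (≰⇒> c≰u) c≤a) (m≤m+n a d)
... | no  c≰u | no  c≰a rewrite bump-< (≰⇒> c≰u) | bump-< (≰⇒> c≰a) = lt

∈-map-bump⁻ : ∀ c {a p} → bump c a ∈ map (bump c) p → a ∈ p
∈-map-bump⁻ c {a} {p} mem with ∈-map⁻ (bump c) mem
... | x , x∈p , eq = subst (_∈ p) (sym (bump-injective c eq)) x∈p

∉-map-bump : ∀ c p → c ∉ map (bump c) p
∉-map-bump c p mem with ∈-map⁻ (bump c) mem
... | x , _ , eq = bump-≢ c x (sym eq)

map-bump-below : ∀ c p → All (_< c) p → map (bump c) p ≡ p
map-bump-below c []      []         = refl
map-bump-below c (x ∷ p) (x<c ∷ p<c) = cong₂ _∷_ (bump-< x<c) (map-bump-below c p p<c)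

length-∷ʳ : ∀ (u : Word) b → length (u ∷ʳ b) ≡ suc (length u)
length-∷ʳ u b = trans (length-++ u) (+-comm (length u) 1)

bumpBefore-beyond : ∀ v {i j} w → j ≤ i → bumpBefore v i j w ≡ w
bumpBefore-beyond v     []      j≤i = refl
bumpBefore-beyond v {i} {j} (a ∷ w) j≤i with i <ᵇ j | <ᵇ⇒< i j
... | true  | i<j = contradiction (i<j tt) (≤⇒≯ j≤i)
... | false | _   = cong (a ∷_) (bumpBefore-beyond v w (m≤n⇒m≤1+n j≤i))

bumpBefore-++ : ∀ v u w {i j} → length u + i ≤ j →
                bumpBefore v i j (u ++ w) ≡ map (bump v) u ++ bumpBefore v (length u + i) j w
bumpBefore-++ v []      w _ = refl
bumpBefore-++ v (a ∷ u) w {i} {j} u+i<j with i <ᵇ j | <⇒<ᵇ (≤-<-trans (m≤n+m i (length u)) u+i<j)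
... | false | ()
... | true  | _ = cong (bump v a ∷_) (begin
  bumpBefore v (suc i) j (u ++ w)
    ≡⟨ bumpBefore-++ v u w (≤-trans (≤-reflexive (+-suc (length u) i)) u+i<j) ⟩
  map (bump v) u ++ bumpBefore v (length u + suc i) j w
    ≡⟨ cong (λ k → map (bump v) u ++ bumpBefore v k j w) (+-suc (length u) i) ⟩
  map (bump v) u ++ bumpBefore v (suc (length u + i)) j w ∎)
  where open ≡-Reasoning

nth-middle : ∀ u b w → nth (u ++ b ∷ w) (suc (length u)) ≡ b
nth-middle []      b w = refl
nth-middle (a ∷ u) b w = nth-middle u b w

M-middle : ∀ u b w → M (u ++ b ∷ w) (suc (length u)) ≡ map (bump b) u ++ b ∷ w
M-middle u b w = begin
  M (u ++ b ∷ w) (suc (length u))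
    ≡⟨ cong (λ v → bumpBefore v 1 (suc (length u)) (u ++ b ∷ w)) (nth-middle u b w) ⟩
  bumpBefore b 1 (suc (length u)) (u ++ b ∷ w)
    ≡⟨ bumpBefore-++ b u (b ∷ w) (≤-reflexive (+-comm (length u) 1)) ⟩
  map (bump b) u ++ bumpBefore b (length u + 1) (suc (length u)) (b ∷ w)
    ≡⟨ cong (map (bump b) u ++_) (bumpBefore-beyond b (b ∷ w) (≤-reflexive (+-comm 1 (length u)))) ⟩
  map (bump b) u ++ b ∷ w ∎
  where open ≡-Reasoning

Prefixwise : (Word → ℕ → Set) → Word → Word → Set
Prefixwise Q pre []      = ⊤
Prefixwise Q pre (a ∷ w) = Q pre a × Prefixwise Q (pre ∷ʳ a) w

Prefixwise-∷ʳ : ∀ {Q} pre w b → Prefixwise Q pre w → Q (pre ++ w) b → Prefixwise Q pre (w ∷ʳ b)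
Prefixwise-∷ʳ {Q} pre []      b _        q = subst (λ p → Q p b) (++-identityʳ pre) q , tt
Prefixwise-∷ʳ {Q} pre (a ∷ w) b (qa , qw) q =
  qa , Prefixwise-∷ʳ (pre ∷ʳ a) w b qw (subst (λ p → Q p b) (sym (++-assoc pre (a ∷ []) w)) q)

Prefixwise-map : ∀ {Q} (f : ℕ → ℕ) → (∀ {p a} → Q p a → Q (map f p) (f a)) →
                 ∀ pre w → Prefixwise Q pre w → Prefixwise Q (map f pre) (map f w)
Prefixwise-map     f pres pre []      _         = tt
Prefixwise-map {Q} f pres pre (a ∷ w) (qa , qw) =
  pres qa , subst (λ p → Prefixwise Q p (map f w)) (map-++ f pre (a ∷ [])) (Prefixwise-map f pres (pre ∷ʳ a) w qw)

lastOr : ℕ → Word → ℕ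
lastOr p []       = p
lastOr p (x ∷ xs) = lastOr x xs

lastOr-∷ʳ : ∀ p xs b → lastOr p (xs ∷ʳ b) ≡ b
lastOr-∷ʳ p []       b = refl
lastOr-∷ʳ p (x ∷ xs) b = lastOr-∷ʳ x xs b

lastOr-map : ∀ (f : ℕ → ℕ) p xs → lastOr (f p) (map f xs) ≡ f (lastOr p xs)
lastOr-map f p []       = refl
lastOr-map f p (x ∷ xs) = lastOr-map f x xs

lastOr≤maxW : ∀ p xs → lastOr p xs ≤ maxW (p ∷ xs)
lastOr≤maxW p []       = m≤m⊔n p 0
lastOr≤maxW p (x ∷ xs) = ≤-trans (lastOr≤maxW x xs) (m≤n⊔m p (maxW (x ∷ xs)))

maxW-∷ʳ : ∀ p a → maxW (p ∷ʳ a) ≡ maxW p ⊔ a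
maxW-∷ʳ []      a = ⊔-identityʳ a
maxW-∷ʳ (x ∷ p) a = trans (cong (x ⊔_) (maxW-∷ʳ p a)) (sym (⊔-assoc x (maxW p) a))

All≤maxW : ∀ p → All (_≤ maxW p) p
All≤maxW []      = []
All≤maxW (x ∷ p) = m≤m⊔n x (maxW p) ∷ All.map (λ y≤ → ≤-trans y≤ (m≤n⊔m x (maxW p))) (All≤maxW p)

Covers : Word → Set
Covers p = ∀ {v} → 1 ≤ v → v ≤ maxW p → v ∈ p

covers-[] : Covers []
covers-[] 1≤v v≤0 = contradiction (≤-trans 1≤v v≤0) λ ()

covers-∷ʳ : ∀ {p a} → Covers p → a ≤ suc (maxW p) → Covers (p ∷ʳ a)
covers-∷ʳ {p} {a} covers a≤ {v} 1≤v v≤max with v ≤? maxW p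
... | yes v≤m = ∈-++⁺ˡ (covers 1≤v v≤m)
... | no  v≰m = ∈-++⁺ʳ p (here (≤-antisym v≤a (≤-trans a≤ (≰⇒> v≰m))))
  where
  v≤m⊔a : v ≤ maxW p ⊔ a
  v≤m⊔a = subst (v ≤_) (maxW-∷ʳ p a) v≤max
  v≤a : v ≤ a
  v≤a with ⊔-sel (maxW p) a
  ... | inj₁ m⊔a≡m = contradiction (subst (v ≤_) m⊔a≡m v≤m⊔a) v≰m
  ... | inj₂ m⊔a≡a = subst (v ≤_) m⊔a≡a v≤m⊔a

covers-∉⇒maxW< : ∀ {p a} → Covers p → 1 ≤ a → a ∉ p → maxW p < a
covers-∉⇒maxW< {p} {a} covers 1≤a a∉p with a ≤? maxW p
... | yes a≤max = contradiction (covers 1≤a a≤max) a∉p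
... | no  a≰max = ≰⇒> a≰max

module _ (d : ℕ) where

  isAscentAfter : Word → ℕ → Bool
  isAscentAfter []       b = true
  isAscentAfter (x ∷ xs) b = lastOr x xs <ᵇ b + d

  isAscentAfter-∷ʳ : ∀ p x b → isAscentAfter (p ∷ʳ x) b ≡ (x <ᵇ b + d)
  isAscentAfter-∷ʳ []      x b = refl
  isAscentAfter-∷ʳ (y ∷ p) x b = cong (_<ᵇ b + d) (lastOr-∷ʳ y p x)

  isAscentAfter-map-bump : ∀ c p a → T (isAscentAfter (map (bump c) p) (bump c a)) → T (isAscentAfter p a)
  isAscentAfter-map-bump c []       a _ = tt
  isAscentAfter-map-bump c (x ∷ xs) a t = <⇒<ᵇ (bump-reflects-ascent c d
    (subst (_< bump c a + d) (lastOr-map (bump c) x xs) (<ᵇ⇒< _ _ t)))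

  isAscentAfter-new-max : ∀ p {a} → maxW p < a → T (isAscentAfter p a)
  isAscentAfter-new-max []       _     = tt
  isAscentAfter-new-max (x ∷ xs) max<a = <⇒<ᵇ (≤-<-trans (lastOr≤maxW x xs) (≤-trans max<a (m≤m+n _ d)))

  length-ascIdxFrom-∷ʳ : ∀ p i xs b → length (ascIdxFrom d p i (xs ∷ʳ b)) ≡
                         length (ascIdxFrom d p i xs) + (if lastOr p xs <ᵇ b + d then 1 else 0)
  length-ascIdxFrom-∷ʳ p i [] b with p <ᵇ b + d
  ... | true  = refl
  ... | false = refl
  length-ascIdxFrom-∷ʳ p i (x ∷ xs) b with p <ᵇ x + d
  ... | true  = cong suc (length-ascIdxFrom-∷ʳ x (suc i) xs b)
  ... | false = length-ascIdxFrom-∷ʳ x (suc i) xs b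

  asc-∷ʳ : ∀ p a → asc d (p ∷ʳ a) ≡ asc d p + (if isAscentAfter p a then 1 else 0)
  asc-∷ʳ []      a = refl
  asc-∷ʳ (x ∷ p) a = cong suc (length-ascIdxFrom-∷ʳ x 2 p a)

  asc-∷ʳ-ascent : ∀ p a → T (isAscentAfter p a) → asc d (p ∷ʳ a) ≡ suc (asc d p)
  asc-∷ʳ-ascent p a t with isAscentAfter p a | asc-∷ʳ p a
  ... | true | eq = trans eq (+-comm (asc d p) 1)

  asc-∷ʳ-nonascent : ∀ p a → ¬ T (isAscentAfter p a) → asc d (p ∷ʳ a) ≡ asc d p
  asc-∷ʳ-nonascent p a ¬t with isAscentAfter p a | asc-∷ʳ p a
  ... | true  | _  = contradiction tt ¬t
  ... | false | eq = trans eq (+-identityʳ (asc d p))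

  -- M(α, j) only changes entries before position j, so the d-ascents of α can be
  -- detected on the original entries while the prefix before them is modified:
  -- prev is the original entry preceding the unscanned suffix.
  hatStep : ℕ → Word → ℕ → Word
  hatStep prev acc b = (if prev <ᵇ b + d then map (bump b) acc else acc) ∷ʳ b

  hatScan : ℕ → Word → Word → Word
  hatScan prev acc []      = acc
  hatScan prev acc (b ∷ w) = hatScan b (hatStep prev acc b) w

  foldl-M-reassoc : ∀ b u w {n} → length u ≡ n →
    foldl M (u ++ b ∷ w) (ascIdxFrom d b (suc (suc n)) w) ≡ foldl M (u ∷ʳ b ++ w) (ascIdxFrom d b (suc (length (u ∷ʳ b))) w)
  foldl-M-reassoc b u w len≡ = cong₂ (λ z k → foldl M z (ascIdxFrom d b (suc k) w))
    (sym (++-assoc u (b ∷ []) w)) (sym (trans (length-∷ʳ u b) (cong suc len≡)))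

  foldl-M-ascIdxFrom : ∀ prev u w → foldl M (u ++ w) (ascIdxFrom d prev (suc (length u)) w) ≡ hatScan prev u w
  foldl-M-ascIdxFrom prev u []      = ++-identityʳ u
  foldl-M-ascIdxFrom prev u (b ∷ w) with prev <ᵇ b + d
  ... | true  = begin
    foldl M (M (u ++ b ∷ w) (suc (length u))) (ascIdxFrom d b (suc (suc (length u))) w)
      ≡⟨ cong (λ z → foldl M z (ascIdxFrom d b (suc (suc (length u))) w)) (M-middle u b w) ⟩
    foldl M (map (bump b) u ++ b ∷ w) (ascIdxFrom d b (suc (suc (length u))) w)
      ≡⟨ foldl-M-reassoc b (map (bump b) u) w (length-map (bump b) u) ⟩
    foldl M (map (bump b) u ∷ʳ b ++ w) (ascIdxFrom d b (suc (length (map (bump b) u ∷ʳ b))) w)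
      ≡⟨ foldl-M-ascIdxFrom b (map (bump b) u ∷ʳ b) w ⟩
    hatScan b (map (bump b) u ∷ʳ b) w ∎
    where open ≡-Reasoning
  ... | false = trans (foldl-M-reassoc b u w refl) (foldl-M-ascIdxFrom b (u ∷ʳ b) w)

  hat-∷ : ∀ a w → hat d (a ∷ w) ≡ hatScan a (a ∷ []) w
  hat-∷ a w = trans (cong (λ z → foldl M (a ∷ z) (ascIdxFrom d a 2 w)) (bumpBefore-beyond a w (s≤s z≤n)))
                    (foldl-M-ascIdxFrom a (a ∷ []) w)

  FreshIfAscent : Word → ℕ → Set
  FreshIfAscent p a = T (isAscentAfter p a) → a ∉ p

  FreshAtAscents : Word → Set
  FreshAtAscents = Prefixwise FreshIfAscent []

  map-bump-FreshIfAscent : ∀ c {p a} → FreshIfAscent p a → FreshIfAscent (map (bump c) p) (bump c a)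
  map-bump-FreshIfAscent c {p} {a} fresh t mem = fresh (isAscentAfter-map-bump c p a t) (∈-map-bump⁻ c mem)

  hatScan-fresh : ∀ prev u w → FreshAtAscents (u ∷ʳ prev) → FreshAtAscents (hatScan prev (u ∷ʳ prev) w)
  hatScan-fresh prev u []      fresh = fresh
  hatScan-fresh prev u (b ∷ w) fresh with prev <ᵇ b + d in ascent
  ... | true  = hatScan-fresh b (map (bump b) (u ∷ʳ prev)) w
    (Prefixwise-∷ʳ [] _ b (Prefixwise-map (bump b) (map-bump-FreshIfAscent b) [] _ fresh)
                          (λ _ → ∉-map-bump b (u ∷ʳ prev)))
  ... | false = hatScan-fresh b (u ∷ʳ prev) w
    (Prefixwise-∷ʳ [] _ b fresh (λ t → ⊥-elim (subst T (trans (isAscentAfter-∷ʳ u prev b) ascent) t)))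

  hat-fresh : ∀ β → FreshAtAscents (hat d β)
  hat-fresh []      = tt
  hat-fresh (a ∷ w) = subst FreshAtAscents (sym (hat-∷ a w)) (hatScan-fresh a [] w ((λ _ ()) , tt))

  RecordIfAscent : Word → ℕ → Set
  RecordIfAscent p a = T (isAscentAfter p a) → All (_< a) p

  RecordAtAscents : Word → Set
  RecordAtAscents = Prefixwise RecordIfAscent []

  hatStep-record : ∀ prev u b → RecordIfAscent (u ∷ʳ prev) b → hatStep prev (u ∷ʳ prev) b ≡ u ∷ʳ prev ∷ʳ b
  hatStep-record prev u b isRecord with prev <ᵇ b + d in ascent
  ... | true  = cong (_∷ʳ b) (map-bump-below b (u ∷ʳ prev)
                  (isRecord (subst T (sym (trans (isAscentAfter-∷ʳ u prev b) ascent)) tt)))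
  ... | false = refl

  hatScan-record : ∀ prev u w → Prefixwise RecordIfAscent (u ∷ʳ prev) w → hatScan prev (u ∷ʳ prev) w ≡ u ∷ʳ prev ++ w
  hatScan-record prev u []      _                 = sym (++-identityʳ (u ∷ʳ prev))
  hatScan-record prev u (b ∷ w) (isRecord , rest) = begin
    hatScan b (hatStep prev (u ∷ʳ prev) b) w ≡⟨ cong (λ acc → hatScan b acc w) (hatStep-record prev u b isRecord) ⟩
    hatScan b (u ∷ʳ prev ∷ʳ b) w           ≡⟨ hatScan-record b (u ∷ʳ prev) w rest ⟩
    u ∷ʳ prev ∷ʳ b ++ w                    ≡⟨ ++-assoc (u ∷ʳ prev) (b ∷ []) w ⟩
    u ∷ʳ prev ++ b ∷ w                     ∎
    where open ≡-Reasoning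

  hat-record : ∀ α → RecordAtAscents α → hat d α ≡ α
  hat-record []      _          = refl
  hat-record (a ∷ w) (_ , rest) = trans (hat-∷ a w) (hatScan-record a [] w rest)

  maxW≤asc-∷ʳ : ∀ p {a} → maxW p ≤ asc d p → a ≤ suc (maxW p) → maxW (p ∷ʳ a) ≤ asc d (p ∷ʳ a)
  maxW≤asc-∷ʳ p {a} max≤asc a≤ with a ≤? maxW p
  ... | yes a≤max = begin
    maxW (p ∷ʳ a)                               ≡⟨ trans (maxW-∷ʳ p a) (m≥n⇒m⊔n≡m a≤max) ⟩
    maxW p                                      ≤⟨ max≤asc ⟩
    asc d p                                     ≤⟨ m≤m+n (asc d p) _ ⟩
    asc d p + (if isAscentAfter p a then 1 else 0) ≡⟨ sym (asc-∷ʳ p a) ⟩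
    asc d (p ∷ʳ a)                              ∎
    where open ≤-Reasoning
  ... | no  a≰max = begin
    maxW (p ∷ʳ a)   ≡⟨ trans (maxW-∷ʳ p a) (m≤n⇒m⊔n≡n (<⇒≤ (≰⇒> a≰max))) ⟩
    a               ≤⟨ a≤ ⟩
    suc (maxW p)    ≤⟨ s≤s max≤asc ⟩
    suc (asc d p)   ≡⟨ sym (asc-∷ʳ-ascent p a (isAscentAfter-new-max p (≰⇒> a≰max))) ⟩
    asc d (p ∷ʳ a)  ∎
    where open ≤-Reasoning

  asc≤maxW-∷ʳ : ∀ p {a} → Covers p → 1 ≤ a → FreshIfAscent p a → asc d p ≤ maxW p → asc d (p ∷ʳ a) ≤ maxW (p ∷ʳ a)
  asc≤maxW-∷ʳ p {a} covers 1≤a fresh asc≤max with T? (isAscentAfter p a)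
  ... | yes ascent = begin
    asc d (p ∷ʳ a)  ≡⟨ asc-∷ʳ-ascent p a ascent ⟩
    suc (asc d p)   ≤⟨ s≤s asc≤max ⟩
    suc (maxW p)    ≤⟨ covers-∉⇒maxW< covers 1≤a (fresh ascent) ⟩
    a               ≤⟨ m≤n⊔m (maxW p) a ⟩
    maxW p ⊔ a      ≡⟨ sym (maxW-∷ʳ p a) ⟩
    maxW (p ∷ʳ a)   ∎
    where open ≤-Reasoning
  ... | no ¬ascent = begin
    asc d (p ∷ʳ a)  ≡⟨ asc-∷ʳ-nonascent p a ¬ascent ⟩
    asc d p         ≤⟨ asc≤max ⟩
    maxW p          ≤⟨ m≤m⊔n (maxW p) a ⟩
    maxW p ⊔ a      ≡⟨ sym (maxW-∷ʳ p a) ⟩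
    maxW (p ∷ʳ a)   ∎
    where open ≤-Reasoning

  RGFCond⇒AscCond : ∀ pre w → maxW pre ≤ asc d pre → RGFCond pre w → AscCond d pre w
  RGFCond⇒AscCond pre []      _       _          = tt
  RGFCond⇒AscCond pre (a ∷ w) max≤asc (a≤ , rgf) =
    ≤-trans a≤ (s≤s max≤asc) , RGFCond⇒AscCond (pre ∷ʳ a) w (maxW≤asc-∷ʳ pre max≤asc a≤) rgf

  AscCond∧fresh⇒RGFCond : ∀ pre w → Covers pre → asc d pre ≤ maxW pre → Positive w →
                          AscCond d pre w → Prefixwise FreshIfAscent pre w → RGFCond pre w
  AscCond∧fresh⇒RGFCond pre []      _      _       _           _           _                = tt
  AscCond∧fresh⇒RGFCond pre (a ∷ w) covers asc≤max (1≤a ∷ pos) (a≤ , ascs) (fresh , freshs) =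
    a≤1+max , AscCond∧fresh⇒RGFCond (pre ∷ʳ a) w (covers-∷ʳ covers a≤1+max)
                (asc≤maxW-∷ʳ pre covers 1≤a fresh asc≤max) pos ascs freshs
    where
    a≤1+max : a ≤ suc (maxW pre)
    a≤1+max = ≤-trans a≤ (s≤s asc≤max)

  RGFCond∧fresh⇒record : ∀ pre w → Covers pre → Positive w →
                         RGFCond pre w → Prefixwise FreshIfAscent pre w → Prefixwise RecordIfAscent pre w
  RGFCond∧fresh⇒record pre []      _      _           _          _                = tt
  RGFCond∧fresh⇒record pre (a ∷ w) covers (1≤a ∷ pos) (a≤ , rgf) (fresh , freshs) =
    (λ ascent → All.map (λ x≤max → ≤-<-trans x≤max (covers-∉⇒maxW< covers 1≤a (fresh ascent))) (All≤maxW pre)) ,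
    RGFCond∧fresh⇒record (pre ∷ʳ a) w (covers-∷ʳ covers a≤) pos rgf freshs

  covers-[1] : Covers (1 ∷ [])
  covers-[1] = covers-∷ʳ covers-[] ≤-refl

  RGF⇒Asc : ∀ α → IsRGF α → IsAsc d α
  RGF⇒Asc []      _                 = [] , tt
  RGF⇒Asc (a ∷ w) (pos , refl , rgf) = pos , ≤-refl , RGFCond⇒AscCond (1 ∷ []) w ≤-refl rgf

  Asc∧fresh⇒RGF : ∀ α → IsAsc d α → FreshAtAscents α → IsRGF α
  Asc∧fresh⇒RGF []      _                            _           = tt
  Asc∧fresh⇒RGF (a ∷ w) (1≤a ∷ pos , a≤1 , ascs) (_ , freshs) with ≤-antisym a≤1 1≤a
  ... | refl = (1≤a ∷ pos) , refl , AscCond∧fresh⇒RGFCond (1 ∷ []) w covers-[1] ≤-refl pos ascs freshs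

  RGF∧fresh⇒record : ∀ α → IsRGF α → FreshAtAscents α → RecordAtAscents α
  RGF∧fresh⇒record []      _                          _           = tt
  RGF∧fresh⇒record (a ∷ w) (_ ∷ pos , refl , rgf) (_ , freshs) =
    (λ _ → []) , RGFCond∧fresh⇒record (1 ∷ []) w covers-[1] pos rgf freshs

proposition3p8 : (d : ℕ) (α : Word) → InTildeA d α ⇔ (InHatA d α × IsRGF α)
proposition3p8 d α = mk⇔ to from
  where
  to : InTildeA d α → InHatA d α × IsRGF α
  to (asc-α , hat≡α) = (α , asc-α , hat≡α) ,
    Asc∧fresh⇒RGF d α asc-α (subst (FreshAtAscents d) hat≡α (hat-fresh d α))

  from : InHatA d α × IsRGF α → InTildeA d α
  from ((β , _ , hat≡α) , rgf) = RGF⇒Asc d α rgf ,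
    hat-record d α (RGF∧fresh⇒record d α rgf (subst (FreshAtAscents d) hat≡α (hat-fresh d β)))
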